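{- Let $n$ be a positive integer such that $s^{n,4}=\binom{n+1}{2}/4$ is an integer, and let $p_1\le p_2\le p_3\le p_4$ be positive integers with $\sum_{i=1}^4 p_i=n$ satisfying $\sum_{i=1}^{P_j}(n-i+1)\ge j\,s^{n,4}$ for $j=1,\dots,4$, where $P_j=\sum_{i=1}^j p_i$. Suppose there is no equitable partition of $[n]$ implementing $\{p_i\}_{i=1}^4$. Then there exists a minimal partition of $[n]$ implementing $\{p_i\}_{i=1}^4$ with finite width.
   Context: $[n]=\{1,\dots,n\}$. For a finite set of integers $A$, $S(A)$ denotes the sum of its elements. A partition $\mathcal{A}=\{A_1,\dots,A_4\}$ of $[n]$ implements $\{p_i\}_{i=1}^4$ if the multiset of sizes $\{|A_1|,\dots,|A_4|\}$ equals the multiset $\{p_1,\dots,p_4\}$. It is equitable if $S(A_i)=s^{n,4}$ for all $i$. For a partition $\mathcal{A}$, $d(\mathcal{A})=\sum_{i=1}^4(S(A_i)-s^{n,4})^2$; a minimal partition is a partition implementing $\{p_i\}$ whose $d$-value is minimal among all partitions of $[n]$ implementing $\{p_i\}$. A set $A\in\mathcal{A}$ is low if $S(A)<s^{n,4}$, high if $S(A)>s^{n,4}$, and exact if $S(A)=s^{n,4}$. For a non-equitable partition $\mathcal{A}$, its width $\omega(\mathcal{A})$ is the minimum of $y-x$ over all $x,y\in[n]$ with $y>x$, $y$ in a high set of $\mathcal{A}$ and $x$ in a low set of $\mathcal{A}$; if no such pair exists, $\omega(\mathcal{A})=\infty$. -}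

module Defs where

open import Data.Nat using (ℕ; zero; suc; _+_; _*_; _∸_; _≤_; _<_)
open import Data.Fin as Fin using (Fin; toℕ; _≟_)
open import Data.List using (List; map; allFin)
open import Data.Nat.ListAction using (sum)
open import Data.Bool using (if_then_else_)
open import Relation.Nullary.Decidable using (⌊_⌋)
open import Data.Integer as ℤ using (ℤ; +_)
open import Data.Product using (∃; ∃-syntax; _×_; _,_)
open import Data.Fin.Permutation using (Permutation′; _⟨$⟩ʳ_)
open import Relation.Binary.PropositionalEquality using (_≡_)
open import Function using (_∋_)

-- A (labelled) partition of [n] into 4 parts A_0..A_3:
-- element (toℕ i + 1) of [n] lies in part f i.
Partition4 : ℕ → Set
Partition4 n = Fin n → Fin 4

size : ∀ {n} → Partition4 n → Fin 4 → ℕ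
size {n} f k = sum (map (λ i → if ⌊ f i ≟ k ⌋ then 1 else 0) (allFin n))

partSum : ∀ {n} → Partition4 n → Fin 4 → ℕ
partSum {n} f k = sum (map (λ i → if ⌊ f i ≟ k ⌋ then suc (toℕ i) else 0) (allFin n))

-- the multiset of part sizes equals the multiset p (given as Fin 4 → ℕ)
Implements : ∀ {n} → (Fin 4 → ℕ) → Partition4 n → Set
Implements p f = ∃[ σ ] (∀ (k : Fin 4) → size f k ≡ p ((Permutation′ 4 ∋ σ) ⟨$⟩ʳ k))

sq : ℤ → ℤ
sq z = z ℤ.* z

dev : ∀ {n} → ℕ → Partition4 n → ℤ
dev s f = sum4 (λ k → sq ((+ partSum f k) ℤ.- (+ s)))
  where
  sum4 : (Fin 4 → ℤ) → ℤ
  sum4 g = g Fin.zero ℤ.+ (g (Fin.suc Fin.zero) ℤ.+ (g (Fin.suc (Fin.suc Fin.zero)) ℤ.+ g (Fin.suc (Fin.suc (Fin.suc Fin.zero)))))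

Equitable : ∀ {n} → ℕ → Partition4 n → Set
Equitable s f = ∀ (k : Fin 4) → partSum f k ≡ s

Minimal : ∀ {n} → ℕ → (Fin 4 → ℕ) → Partition4 n → Set
Minimal {n} s p f = Implements p f × (∀ (g : Partition4 n) → Implements p g → dev s f ℤ.≤ dev s g)

InLow : ∀ {n} → ℕ → Partition4 n → Fin n → Set
InLow s f x = partSum f (f x) < s

InHigh : ∀ {n} → ℕ → Partition4 n → Fin n → Set
InHigh s f y = s < partSum f y'
  where y' = f y

-- ω(A) < ∞ : by definition of the width (minimum over an empty set is ∞),
-- the width is finite iff some pair x < y exists with y in a high set and
-- x in a low set.
FiniteWidth : ∀ {n} → ℕ → Partition4 n → Set
FiniteWidth {n} s f = ∃[ x ] ∃[ y ] (toℕ x < toℕ y × InHigh s f y × InLow s f x)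

topSum : ℕ → ℕ → ℕ
topSum n zero = 0
topSum n (suc k) = topSum n k + (n ∸ k)

-- Take a minimal labelled partition f with |A_k| = p_k (it exists by exhaustive search, and it is
-- minimal among all implementations since d is invariant under relabelling), and suppose its width
-- is infinite, i.e. no low element lies below a high one.  The condition on the top sums says that a
-- union of j parts of sum at most s, one of them below s, cannot consist of the largest elements,
-- so it contains an element x whose successor x + 1 lies outside.  Exchanging x and x + 1 changes d
-- by 2 (S(f x) + 1 − S(f (x + 1))), so minimality gives S(f (x + 1)) ≤ S(f x) + 1, with a minimal
-- exchange in case of equality.  Applied to the non-high and to the low parts this yields an exact
-- part E′ right below a part A with S(A) = s + 1, and a part B with S(B) = s − 1 right below an
-- exact part E; the exchanges h across E′ | A and g across B | E are again minimal.  If neither has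
-- finite width, the same argument for B ∪ E finds y ∈ B ∪ E with y + 1 ∈ A ∪ E′; every such
-- configuration gives finite width of f, g or h, except y ∈ E, y + 1 ∈ E′, where exchanging them
-- inside g leaves E′ with sum s − 1 directly below A.

module Submission where

open import Defs
open import Data.Nat using (ℕ; zero; suc; _+_; _*_; _≤_; _<_)
open import Data.Nat.Combinatorics using (_C_)
open import Data.Fin using (Fin)
open import Data.Product using (∃; ∃-syntax; _×_; _,_)
open import Data.Vec using (Vec; _∷_; []; lookup)
open import Relation.Binary.PropositionalEquality using (_≡_)
open import Relation.Nullary using (¬_)

import Data.Nat as ℕ
open import Data.Nat using (_∸_; z≤n; s≤s; _≤′_; ≤′-refl; ≤′-step)
open import Data.Nat.Properties hiding (_≟_)
open import Data.Nat.Combinatorics using (nC1≡n; nCk+nC[k+1]≡[n+1]C[k+1])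
open import Data.Nat.ListAction using (sum)
open import Data.Nat.Tactic.RingSolver using (solve-∀)
open import Data.Integer as ℤ using (ℤ)
import Data.Integer.Properties as ℤₚ
import Data.Integer.Tactic.RingSolver as ℤSolver
open import Data.Fin as Fin using (zero; suc; toℕ; _≟_)
import Data.Fin.Properties as Finₚ
open import Data.Fin.Permutation as Perm using (Permutation′; _⟨$⟩ʳ_; _⟨$⟩ˡ_)
import Data.Fin.Permutation.Components as PC
open import Data.Bool as Bool using (Bool; true; false; if_then_else_)
open import Data.Empty using (⊥; ⊥-elim)
open import Data.Unit using (⊤; tt)
open import Data.Product using (proj₁)
open import Data.Sum using (_⊎_; inj₁; inj₂; [_,_]′)
open import Data.List as List using (List; allFin)
open import Data.List.Properties using (map-tabulate)
open import Data.List.Membership.Propositional using (_∈_)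
open import Data.List.Membership.Propositional.Properties using (∈-allFin; ∈-cartesianProductWith⁺; ∈-filter⁺)
open import Data.List.Relation.Unary.Any using (here)
import Data.List.Relation.Unary.All as All
open import Data.List.Relation.Unary.All.Properties using (all-filter)
open import Data.List.Extrema ℤₚ.≤-totalOrder using (argmin; argmin-all; f[argmin]≤f[xs])
open import Data.Vec.Functional as Vector using (removeAt; updateAt)
open import Data.Vec.Functional.Properties using (updateAt-updates; updateAt-minimal)
import Algebra.Properties.CommutativeMonoid.Sum
open Algebra.Properties.CommutativeMonoid.Sum +-0-commutativeMonoid
  using (sum-syntax; ∑-distrib-+; ∑-comm; sum-permute)
  renaming (sum to ∑; sum-cong-≗ to ∑-cong)
open import Function using (_∘_; const)
open import Relation.Binary using (tri<; tri≈; tri>)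
open import Relation.Binary.PropositionalEquality
  using (_≢_; _≗_; refl; sym; trans; cong; cong₂; subst; subst₂; module ≡-Reasoning)
open import Relation.Nullary.Decidable
  using (Dec; does; yes; no; ⌊_⌋; ⌊⌋-map′; _×-dec_; _⊎-dec_; _→-dec_; ¬?; from-yes; dec-true; dec-false)

when : Bool → ℕ → ℕ
when b v = if b then v else 0

when-≤ : ∀ b v → when b v ≤ v
when-≤ true  v = ≤-refl
when-≤ false v = z≤n

when-+ : ∀ b x y → when b (x + y) ≡ when b x + when b y
when-+ true  x y = refl
when-+ false x y = refl

when-comm : ∀ b c v → when b (when c v) ≡ when c (when b v)
when-comm true  c     v = refl
when-comm false true  v = refl
when-comm false false v = refl

∑-const : ∀ n c → ∑[ i < n ] c ≡ n * c
∑-const zero    c = refl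
∑-const (suc n) c = cong (c +_) (∑-const n c)

∑-zero : ∀ n → ∑[ i < n ] 0 ≡ 0
∑-zero n = trans (∑-const n 0) (*-zeroʳ n)

∑-ones : ∀ n → ∑[ i < n ] 1 ≡ n
∑-ones n = trans (∑-const n 1) (*-identityʳ n)

∑-mono-≤ : ∀ {n} {u v : Fin n → ℕ} → (∀ i → u i ≤ v i) → ∑ u ≤ ∑ v
∑-mono-≤ {zero}  _  = z≤n
∑-mono-≤ {suc n} le = +-mono-≤ (le zero) (∑-mono-≤ (le ∘ suc))

∑-mono-< : ∀ {n} {u v : Fin n → ℕ} → (∀ i → u i ≤ v i) → ∀ j → u j < v j → ∑ u < ∑ v
∑-mono-< le zero    lt = +-mono-<-≤ lt (∑-mono-≤ (le ∘ suc))
∑-mono-< le (suc j) lt = +-mono-≤-< (le zero) (∑-mono-< (le ∘ suc) j lt)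

when-∑ : ∀ {n} b (g : Fin n → ℕ) → when b (∑ g) ≡ ∑[ i < n ] when b (g i)
when-∑     true  g = refl
when-∑ {n} false g = sym (∑-zero n)

∑-δ : ∀ {m} (c : Fin m) (F : Fin m → ℕ) → ∑[ k < m ] when ⌊ c ≟ k ⌋ (F k) ≡ F c
∑-δ {suc m} zero    F = trans (cong (F zero +_) (∑-zero m)) (+-identityʳ (F zero))
∑-δ {suc m} (suc c) F =
  trans (∑-cong (λ k → cong (λ b → when b (F (suc k))) (⌊⌋-map′ _ _ (c ≟ k)))) (∑-δ c (F ∘ suc))

∑-splitAt : ∀ a {b} (h : Fin (a + b) → ℕ) → ∑ h ≡ ∑ (h ∘ (Fin._↑ˡ b)) + ∑ (h ∘ (a Fin.↑ʳ_))
∑-splitAt zero    h = refl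
∑-splitAt (suc a) h = trans (cong (h zero +_) (∑-splitAt a (h ∘ suc))) (sym (+-assoc (h zero) _ _))

∑-suc-toℕ : ∀ n → ∑[ i < n ] suc (toℕ i) ≡ suc n C 2
∑-suc-toℕ zero    = refl
∑-suc-toℕ (suc n) = begin
  1 + ∑[ i < n ] (1 + suc (toℕ i))            ≡⟨ cong (1 +_) (∑-distrib-+ {n} (const 1) (λ i → suc (toℕ i))) ⟩
  1 + (∑[ i < n ] 1 + ∑[ i < n ] suc (toℕ i)) ≡⟨ cong₂ (λ a b → 1 + (a + b)) (∑-ones n) (∑-suc-toℕ n) ⟩
  suc n + suc n C 2                           ≡⟨ cong (_+ suc n C 2) (nC1≡n (suc n)) ⟨
  suc n C 1 + suc n C 2                       ≡⟨ nCk+nC[k+1]≡[n+1]C[k+1] (suc n) 1 ⟩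
  suc (suc n) C 2                             ∎
  where open ≡-Reasoning

sumOver : ∀ {n} → (Fin n → Bool) → (Fin n → ℕ) → ℕ
sumOver {n} Q w = ∑[ i < n ] when (Q i) (w i)

count : ∀ {n} → (Fin n → Bool) → ℕ
count Q = sumOver Q (const 1)

sumOver-const : ∀ {m} (T : Fin m → Bool) c → sumOver T (const c) ≡ count T * c
sumOver-const {zero}  T c = refl
sumOver-const {suc m} T c = trans (cong (when (T zero) c +_) (sumOver-const (T ∘ suc) c)) (head (T zero))
  where
  head : ∀ b → when b c + count (T ∘ suc) * c ≡ (when b 1 + count (T ∘ suc)) * c
  head true  = refl
  head false = refl

sumOver-shift : ∀ {n} (Q : Fin n → Bool) → sumOver Q (λ i → suc (suc (toℕ i))) ≡ count Q + sumOver Q (λ i → suc (toℕ i))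
sumOver-shift {n} Q = trans (∑-cong (λ i → when-+ (Q i) 1 (suc (toℕ i)))) (∑-distrib-+ {n} _ _)

count≤ : ∀ {n} (Q : Fin n → Bool) → count Q ≤ n
count≤ {n} Q = subst (count Q ≤_) (∑-ones n) (∑-mono-≤ (λ i → when-≤ (Q i) 1))

weight : ∀ {n m} → (Fin n → ℕ) → (Fin n → Fin m) → Fin m → ℕ
weight w f k = sumOver (λ i → ⌊ f i ≟ k ⌋) w

labelCount : ∀ {n m} → (Fin n → Fin m) → Fin m → ℕ
labelCount = weight (const 1)

labelSum : ∀ {n m} → (Fin n → Fin m) → Fin m → ℕ
labelSum = weight (λ i → suc (toℕ i))

sum-map-allFin : ∀ n (h : Fin n → ℕ) → sum (List.map h (allFin n)) ≡ ∑ h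
sum-map-allFin zero    h = refl
sum-map-allFin (suc n) h = cong (h zero +_) (begin
  sum (List.map h (List.tabulate suc))         ≡⟨ cong sum (map-tabulate suc h) ⟩
  sum (List.tabulate (h ∘ suc))                ≡⟨ cong sum (map-tabulate (λ i → i) (h ∘ suc)) ⟨
  sum (List.map (h ∘ suc) (allFin n))          ≡⟨ sum-map-allFin n (h ∘ suc) ⟩
  ∑ (h ∘ suc)                                  ∎)
  where open ≡-Reasoning

size≡labelCount : ∀ {n} (f : Partition4 n) k → size f k ≡ labelCount f k
size≡labelCount {n} f k = sum-map-allFin n _

partSum≡labelSum : ∀ {n} (f : Partition4 n) k → partSum f k ≡ labelSum f k
partSum≡labelSum {n} f k = sum-map-allFin n _

sumOver-∘ : ∀ {n m} (T : Fin m → Bool) (w : Fin n → ℕ) (f : Fin n → Fin m) →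
            sumOver (T ∘ f) w ≡ sumOver T (weight w f)
sumOver-∘ {n} {m} T w f = begin
  ∑[ i < n ] when (T (f i)) (w i)
    ≡⟨ ∑-cong (λ i → ∑-δ (f i) (λ k → when (T k) (w i))) ⟨
  ∑[ i < n ] ∑[ k < m ] when ⌊ f i ≟ k ⌋ (when (T k) (w i))
    ≡⟨ ∑-comm {n} {m} (λ i k → when ⌊ f i ≟ k ⌋ (when (T k) (w i))) ⟩
  ∑[ k < m ] ∑[ i < n ] when ⌊ f i ≟ k ⌋ (when (T k) (w i))
    ≡⟨ ∑-cong (λ k → trans (∑-cong (λ i → when-comm ⌊ f i ≟ k ⌋ (T k) (w i)))
                                   (sym (when-∑ (T k) (λ i → when ⌊ f i ≟ k ⌋ (w i))))) ⟩
  ∑[ k < m ] when (T k) (weight w f k) ∎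
  where open ≡-Reasoning

∑-labelSum : ∀ {n m} (f : Fin n → Fin m) → ∑[ k < m ] labelSum f k ≡ ∑[ i < n ] suc (toℕ i)
∑-labelSum f = sym (sumOver-∘ (const true) (λ i → suc (toℕ i)) f)

-- Prefix sums of sorted sequences

prefixSum : ∀ {m} → (Fin m → ℕ) → ℕ → ℕ
prefixSum {zero}  p c       = 0
prefixSum {suc m} p zero    = 0
prefixSum {suc m} p (suc c) = p zero + prefixSum (p ∘ suc) c

Sorted : ∀ {m} → (Fin m → ℕ) → Set
Sorted {zero}        p = ⊤
Sorted {suc zero}    p = ⊤
Sorted {suc (suc m)} p = p zero ≤ p (suc zero) × Sorted (p ∘ suc)

Sorted-tail : ∀ {m} {p : Fin (suc m) → ℕ} → Sorted p → Sorted (p ∘ suc)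
Sorted-tail {zero}  _          = tt
Sorted-tail {suc m} (_ , sorted) = sorted

prefixSum-≤-tail : ∀ {m} {p : Fin (suc m) → ℕ} → Sorted p → ∀ c → c ≤ m → prefixSum p c ≤ prefixSum (p ∘ suc) c
prefixSum-≤-tail         _                zero    _         = z≤n
prefixSum-≤-tail {suc m} (p₀≤p₁ , sorted) (suc c) (s≤s c≤m) = +-mono-≤ p₀≤p₁ (prefixSum-≤-tail sorted c c≤m)

prefixSum≤sumOver : ∀ {m} {p : Fin m → ℕ} → Sorted p → ∀ T → prefixSum p (count T) ≤ sumOver T p
prefixSum≤sumOver {zero}      _      T = z≤n
prefixSum≤sumOver {suc m} {p} sorted T = head (T zero)
  where
  T′ = T ∘ suc
  IH = prefixSum≤sumOver (Sorted-tail sorted) T′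
  head : ∀ b → prefixSum p (when b 1 + count T′) ≤ when b (p zero) + sumOver T′ (p ∘ suc)
  head true  = +-monoʳ-≤ (p zero) IH
  head false = ≤-trans (prefixSum-≤-tail sorted (count T′) (count≤ T′)) IH

topSum-suc : ∀ n c → c ≤ n → topSum (suc n) c ≡ topSum n c + c
topSum-suc n zero    _   = refl
topSum-suc n (suc c) c<n = begin
  topSum (suc n) c + (suc n ∸ c)   ≡⟨ cong₂ _+_ (topSum-suc n c c≤n) (+-∸-assoc 1 c≤n) ⟩
  topSum n c + c + suc (n ∸ c)     ≡⟨ exchange (topSum n c) c (n ∸ c) ⟩
  topSum n c + (n ∸ c) + suc c     ∎
  where
  open ≡-Reasoning
  c≤n = <⇒≤ c<n
  exchange : ∀ a c d → a + c + suc d ≡ a + d + suc c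
  exchange = solve-∀

topSum-mono : ∀ n {c c′} → c ≤ c′ → topSum n c ≤ topSum n c′
topSum-mono n = mono′ ∘ ≤⇒≤′
  where
  mono′ : ∀ {c c′} → c ≤′ c′ → topSum n c ≤ topSum n c′
  mono′ ≤′-refl       = ≤-refl
  mono′ (≤′-step c≤′) = ≤-trans (mono′ c≤′) (m≤m+n _ _)

Adjacent : ∀ {n} → Fin n → Fin n → Set
Adjacent x y = toℕ y ≡ suc (toℕ x)

HasDrop : ∀ {n} → (Fin n → Bool) → Set
HasDrop Q = ∃[ x ] ∃[ y ] (Adjacent x y × Q x ≡ true × Q y ≡ false)

hasDrop? : ∀ {n} (Q : Fin n → Bool) → Dec (HasDrop Q)
hasDrop? Q = Finₚ.any? λ x → Finₚ.any? λ y →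
  (toℕ y ℕ.≟ suc (toℕ x)) ×-dec (Q x Bool.≟ true) ×-dec (Q y Bool.≟ false)

HasDrop-tail : ∀ {n} {Q : Fin (suc n) → Bool} → HasDrop (Q ∘ suc) → HasDrop Q
HasDrop-tail (x , y , adj , Qx , Qy) = suc x , suc y , cong suc adj , Qx , Qy

noDrop⇒all-true : ∀ {n} (Q : Fin (suc n) → Bool) → ¬ HasDrop Q → Q zero ≡ true → ∀ i → Q i ≡ true
noDrop⇒all-true         Q noDrop Q₀ zero    = Q₀
noDrop⇒all-true {suc n} Q noDrop Q₀ (suc i) = noDrop⇒all-true (Q ∘ suc) (noDrop ∘ HasDrop-tail) Q₁ i
  where
  Q₁ : Q (suc zero) ≡ true
  Q₁ with Q (suc zero) in Q₁≡
  ... | true  = refl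
  ... | false = ⊥-elim (noDrop (zero , suc zero , refl , Q₀ , Q₁≡))

-- Without a drop the selected elements are the largest ones, so their sum is a top sum.
topSum≤sumOver : ∀ {n} (Q : Fin n → Bool) → ¬ HasDrop Q → topSum n (count Q) ≤ sumOver Q (λ i → suc (toℕ i))
topSum≤sumOver {zero}  Q _      = z≤n
topSum≤sumOver {suc n} Q noDrop = head (Q zero) all-selected
  where
  open ≤-Reasoning
  Q′ = Q ∘ suc
  c′ = count Q′
  σ′ = sumOver Q′ (λ i → suc (toℕ i))
  IH : topSum n c′ ≤ σ′
  IH = topSum≤sumOver Q′ (noDrop ∘ HasDrop-tail)
  all-selected : Q zero ≡ true → c′ ≡ n
  all-selected Q₀ = trans (∑-cong (λ i → cong (λ b → when b 1) (noDrop⇒all-true Q noDrop Q₀ (suc i))))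
                          (∑-ones n)
  head : ∀ b → (b ≡ true → c′ ≡ n) →
         topSum (suc n) (when b 1 + c′) ≤ when b 1 + sumOver Q′ (λ i → suc (suc (toℕ i)))
  head false _ = begin
    topSum (suc n) c′  ≡⟨ topSum-suc n c′ (count≤ Q′) ⟩
    topSum n c′ + c′   ≤⟨ +-monoˡ-≤ c′ IH ⟩
    σ′ + c′            ≡⟨ +-comm σ′ c′ ⟩
    c′ + σ′            ≡⟨ sumOver-shift Q′ ⟨
    sumOver Q′ (λ i → suc (suc (toℕ i))) ∎
  head true all = begin
    topSum (suc n) (suc c′)         ≡⟨ cong (λ c → topSum (suc n) (suc c)) c′≡n ⟩
    topSum (suc n) n + (suc n ∸ n)  ≡⟨ cong₂ _+_ (topSum-suc n n ≤-refl) (m+n∸n≡m 1 n) ⟩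
    topSum n n + n + 1              ≤⟨ +-monoˡ-≤ 1 (+-monoˡ-≤ n (subst (λ c → topSum n c ≤ σ′) c′≡n IH)) ⟩
    σ′ + n + 1                      ≡⟨ rearrange σ′ n ⟩
    suc (n + σ′)                    ≡⟨ cong (λ c → suc (c + σ′)) c′≡n ⟨
    suc (c′ + σ′)                   ≡⟨ cong suc (sumOver-shift Q′) ⟨
    suc (sumOver Q′ (λ i → suc (suc (toℕ i)))) ∎
    where
    c′≡n = all refl
    rearrange : ∀ a n → a + n + 1 ≡ suc (n + a)
    rearrange = solve-∀

-- The paper's condition ∑_{i ≤ P_j} (n − i + 1) ≥ j s for j ≤ m, with P_j = prefixSum p j.
TopSumCondition : ∀ {m} → ℕ → ℕ → (Fin m → ℕ) → Set
TopSumCondition {m} n s p = ∀ c → c ≤ m → c * s ≤ topSum n (prefixSum p c)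

-- A union of parts, none above s and one below, cannot consist of the largest elements:
-- their sum would be at least a top sum, which the condition bounds below by (number of parts) * s.
drop-in-underfull-union :
  ∀ {n m s} {p : Fin m → ℕ} → Sorted p → TopSumCondition n s p →
  (f : Fin n → Fin m) → (∀ k → labelCount f k ≡ p k) →
  (T : Fin m → Bool) → (∀ k → T k ≡ true → labelSum f k ≤ s) →
  ∀ k₀ → T k₀ ≡ true → labelSum f k₀ < s → HasDrop (T ∘ f)
drop-in-underfull-union {n} {m} {s} {p} sorted condition f sizes T ≤s k₀ Tk₀ k₀<s
  with hasDrop? (T ∘ f)
... | yes drop   = drop
... | no  noDrop = ⊥-elim (<⇒≱ upper lower)
  where
  open ≤-Reasoning
  c = count T
  selected = sumOver (T ∘ f) (λ i → suc (toℕ i))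
  lower : c * s ≤ selected
  lower = begin
    c * s                     ≤⟨ condition c (count≤ T) ⟩
    topSum n (prefixSum p c)  ≤⟨ topSum-mono n (prefixSum≤sumOver sorted T) ⟩
    topSum n (sumOver T p)    ≡⟨ cong (topSum n) (∑-cong (λ k → cong (when (T k)) (sizes k))) ⟨
    topSum n (sumOver T (labelCount f)) ≡⟨ cong (topSum n) (sumOver-∘ T (const 1) f) ⟨
    topSum n (count (T ∘ f))  ≤⟨ topSum≤sumOver (T ∘ f) noDrop ⟩
    selected                  ∎
  bounded : ∀ k → when (T k) (labelSum f k) ≤ when (T k) s
  bounded k with T k in Tk
  ... | true  = ≤s k Tk
  ... | false = z≤n
  upper : selected < c * s
  upper = begin-strict
    selected                  ≡⟨ sumOver-∘ T (λ i → suc (toℕ i)) f ⟩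
    sumOver T (labelSum f)    <⟨ ∑-mono-< bounded k₀ (subst (λ b → when b (labelSum f k₀) < when b s) (sym Tk₀) k₀<s) ⟩
    sumOver T (const s)       ≡⟨ sumOver-const T s ⟩
    c * s                     ∎

-- Exchanging two elements

δ : ∀ {n} → Fin n → Fin n → ℕ
δ a b = when ⌊ a ≟ b ⌋ 1

δ-refl : ∀ {n} (a : Fin n) → δ a a ≡ 1
δ-refl a with a ≟ a
... | yes _   = refl
... | no  a≢a = ⊥-elim (a≢a refl)

δ-≢ : ∀ {n} {a b : Fin n} → a ≢ b → δ a b ≡ 0
δ-≢ {a = a} {b} a≢b with a ≟ b
... | yes a≡b = ⊥-elim (a≢b a≡b)
... | no  _   = refl

δ-suc : ∀ {n} (a b : Fin n) → δ (suc a) (suc b) ≡ δ a b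
δ-suc a b = cong (λ c → when c 1) (⌊⌋-map′ _ _ (a ≟ b))

weight-cong : ∀ {n m} {u v : Fin n → ℕ} {f g : Fin n → Fin m} → u ≗ v → f ≗ g → weight u f ≗ weight v g
weight-cong u≗v f≗g k = ∑-cong (λ i → cong₂ (λ c x → when ⌊ c ≟ k ⌋ x) (f≗g i) (u≗v i))

weight-+ : ∀ {n m} (u v : Fin n → ℕ) (f : Fin n → Fin m) k →
           weight (λ i → u i + v i) f k ≡ weight u f k + weight v f k
weight-+ {n} u v f k = trans (∑-cong (λ i → when-+ ⌊ f i ≟ k ⌋ (u i) (v i))) (∑-distrib-+ {n} _ _)

weight-δ : ∀ {n m} (y : Fin n) (f : Fin n → Fin m) k → weight (δ y) f k ≡ δ (f y) k
weight-δ y f k = trans (∑-cong (λ i → when-comm ⌊ f i ≟ k ⌋ ⌊ y ≟ i ⌋ 1)) (∑-δ y (λ i → δ (f i) k))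

weight-∘-permutation : ∀ {n m} (w : Fin n → ℕ) (f : Fin n → Fin m) (π : Permutation′ n) k →
                       weight w (f ∘ (π ⟨$⟩ʳ_)) k ≡ weight (w ∘ (π ⟨$⟩ˡ_)) f k
weight-∘-permutation w f π k =
  trans (sum-permute _ (Perm.flip π)) (∑-cong (λ j → cong (λ i → when ⌊ f i ≟ k ⌋ (w (π ⟨$⟩ˡ j))) (Perm.inverseʳ π)))

relabel-≟ : ∀ {m} (π : Permutation′ m) c k → ⌊ π ⟨$⟩ʳ c ≟ k ⌋ ≡ ⌊ c ≟ π ⟨$⟩ˡ k ⌋
relabel-≟ π c k with π ⟨$⟩ʳ c ≟ k | c ≟ π ⟨$⟩ˡ k
... | yes _   | yes _   = refl
... | no  _   | no  _   = refl
... | yes πc≡k | no  c≢k = ⊥-elim (c≢k (trans (sym (Perm.inverseˡ π)) (cong (π ⟨$⟩ˡ_) πc≡k)))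
... | no  πc≢k | yes c≡k = ⊥-elim (πc≢k (trans (cong (π ⟨$⟩ʳ_) c≡k) (Perm.inverseʳ π)))

weight-relabel : ∀ {n m} (w : Fin n → ℕ) (f : Fin n → Fin m) (π : Permutation′ m) k →
                 weight w ((π ⟨$⟩ʳ_) ∘ f) k ≡ weight w f (π ⟨$⟩ˡ k)
weight-relabel w f π k = ∑-cong (λ i → cong (λ b → when b (w i)) (relabel-≟ π (f i) k))

transpose-at-x : ∀ {n} (x y : Fin n) → PC.transpose x y x ≡ y
transpose-at-x x y rewrite dec-true (x ≟ x) refl = refl

transpose-at-y : ∀ {n} (x y : Fin n) → PC.transpose x y y ≡ x
transpose-at-y x y with y ≟ x
... | yes refl = refl
... | no  _    rewrite dec-true (y ≟ y) refl = refl

transpose-other : ∀ {n} {x y i : Fin n} → i ≢ x → i ≢ y → PC.transpose x y i ≡ i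
transpose-other {x = x} {y} {i} i≢x i≢y rewrite dec-false (i ≟ x) i≢x | dec-false (i ≟ y) i≢y = refl

swapAt : ∀ {n m} → (Fin n → Fin m) → Fin n → Fin n → Fin n → Fin m
swapAt f x y = f ∘ (Perm.transpose x y ⟨$⟩ʳ_)

swapAt-other : ∀ {n m} (f : Fin n → Fin m) {x y i} → i ≢ x → i ≢ y → swapAt f x y i ≡ f i
swapAt-other f i≢x i≢y = cong f (transpose-other i≢x i≢y)

labelCount-swapAt : ∀ {n m} (f : Fin n → Fin m) x y → labelCount (swapAt f x y) ≗ labelCount f
labelCount-swapAt f x y = weight-∘-permutation (const 1) f (Perm.transpose x y)

Adjacent⇒≢ : ∀ {n} {x y : Fin n} → Adjacent x y → x ≢ y
Adjacent⇒≢ adj refl = 1+n≢n (sym adj)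

-- v is u with one unit moved from L to K.
MovesUnit : ∀ {m} → (Fin m → ℕ) → (Fin m → ℕ) → Fin m → Fin m → Set
MovesUnit u v L K = ∀ k → v k + δ L k ≡ u k + δ K k

-- Swapping x with its successor y trades the value x + 1 for x + 2 in the part of x.
labelSum-swapAt : ∀ {n m} (f : Fin n → Fin m) {x y} → Adjacent x y →
                  MovesUnit (labelSum f) (labelSum (swapAt f x y)) (f y) (f x)
labelSum-swapAt f {x} {y} adj k = begin
  labelSum (swapAt f x y) k + δ (f y) k
    ≡⟨ cong₂ _+_ (weight-∘-permutation _ f (Perm.transpose x y) k) (sym (weight-δ y f k)) ⟩
  weight (λ j → suc (toℕ (τ j))) f k + weight (δ y) f k
    ≡⟨ weight-+ _ (δ y) f k ⟨
  weight (λ j → suc (toℕ (τ j)) + δ y j) f k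
    ≡⟨ weight-cong values (λ _ → refl) k ⟩
  weight (λ j → suc (toℕ j) + δ x j) f k
    ≡⟨ weight-+ _ (δ x) f k ⟩
  labelSum f k + weight (δ x) f k
    ≡⟨ cong (labelSum f k +_) (weight-δ x f k) ⟩
  labelSum f k + δ (f x) k
    ∎
  where
  open ≡-Reasoning
  τ = PC.transpose y x
  x≢y = Adjacent⇒≢ adj
  values′ : ∀ j → Dec (j ≡ x) → Dec (j ≡ y) → suc (toℕ (τ j)) + δ y j ≡ suc (toℕ j) + δ x j
  values′ j (yes refl) _
    rewrite transpose-at-y y x | δ-≢ (x≢y ∘ sym) | δ-refl x = trans (+-identityʳ _) (trans (cong suc adj) (+-comm 1 _))
  values′ j (no _) (yes refl)
    rewrite transpose-at-x y x | δ-refl y | δ-≢ x≢y = trans (+-comm _ 1) (trans (cong suc (sym adj)) (sym (+-identityʳ _)))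
  values′ j (no j≢x) (no j≢y)
    rewrite transpose-other j≢y j≢x | δ-≢ (j≢y ∘ sym) | δ-≢ (j≢x ∘ sym) = refl
  values : ∀ j → suc (toℕ (τ j)) + δ y j ≡ suc (toℕ j) + δ x j
  values j = values′ j (j ≟ x) (j ≟ y)

moves-gain : ∀ {m} {u v : Fin m → ℕ} {L K} → MovesUnit u v L K → K ≢ L → v K ≡ suc (u K)
moves-gain {u = u} {v} {L} {K} moves K≢L = begin
  v K          ≡⟨ +-identityʳ (v K) ⟨
  v K + 0      ≡⟨ cong (v K +_) (δ-≢ (K≢L ∘ sym)) ⟨
  v K + δ L K  ≡⟨ moves K ⟩
  u K + δ K K  ≡⟨ cong (u K +_) (δ-refl K) ⟩
  u K + 1      ≡⟨ +-comm (u K) 1 ⟩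
  suc (u K)    ∎
  where open ≡-Reasoning

moves-loss : ∀ {m} {u v : Fin m → ℕ} {L K} → MovesUnit u v L K → K ≢ L → u L ≡ suc (v L)
moves-loss {u = u} {v} {L} {K} moves K≢L = begin
  u L          ≡⟨ +-identityʳ (u L) ⟨
  u L + 0      ≡⟨ cong (u L +_) (δ-≢ K≢L) ⟨
  u L + δ K L  ≡⟨ moves L ⟨
  v L + δ L L  ≡⟨ cong (v L +_) (δ-refl L) ⟩
  v L + 1      ≡⟨ +-comm (v L) 1 ⟩
  suc (v L)    ∎
  where open ≡-Reasoning

moves-other : ∀ {m} {u v : Fin m → ℕ} {L K j} → MovesUnit u v L K → j ≢ K → j ≢ L → v j ≡ u j
moves-other {u = u} {v} {L} {K} {j} moves j≢K j≢L = +-cancelʳ-≡ 0 (v j) (u j) (begin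
  v j + 0      ≡⟨ cong (v j +_) (δ-≢ (j≢L ∘ sym)) ⟨
  v j + δ L j  ≡⟨ moves j ⟩
  u j + δ K j  ≡⟨ cong (u j +_) (δ-≢ (j≢K ∘ sym)) ⟩
  u j + 0      ∎)
  where open ≡-Reasoning

-- The deviation

module ℤΣ = Algebra.Properties.CommutativeMonoid.Sum ℤₚ.+-0-commutativeMonoid

sum-differ-at : ∀ {n} (t t′ : Fin n → ℤ) K → (∀ j → j ≢ K → t j ≡ t′ j) →
                ℤΣ.sum t ≡ ℤΣ.sum t′ ℤ.+ (t K ℤ.- t′ K)
sum-differ-at {suc n} t t′ K agree = begin
  ℤΣ.sum t                                        ≡⟨ ℤΣ.sum-remove t ⟩
  t K ℤ.+ ℤΣ.sum (removeAt t K)                   ≡⟨ cong (λ r → t K ℤ.+ r) (ℤΣ.sum-cong-≗ rest-agree) ⟩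
  t K ℤ.+ ℤΣ.sum (removeAt t′ K)                  ≡⟨ regroup (t K) (t′ K) _ ⟩
  (t′ K ℤ.+ ℤΣ.sum (removeAt t′ K)) ℤ.+ (t K ℤ.- t′ K) ≡⟨ cong (ℤ._+ (t K ℤ.- t′ K)) (ℤΣ.sum-remove t′) ⟨
  ℤΣ.sum t′ ℤ.+ (t K ℤ.- t′ K)                    ∎
  where
  open ≡-Reasoning
  rest-agree : removeAt t K ≗ removeAt t′ K
  rest-agree j = agree _ (Finₚ.punchInᵢ≢i K j)
  regroup : ∀ a b r → a ℤ.+ r ≡ (b ℤ.+ r) ℤ.+ (a ℤ.- b)
  regroup = ℤSolver.solve-∀

sum-differ-at₂ : ∀ {n} (t t′ : Fin n → ℤ) {K L} → K ≢ L → (∀ j → j ≢ K → j ≢ L → t j ≡ t′ j) →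
                 ℤΣ.sum t ≡ ℤΣ.sum t′ ℤ.+ (t K ℤ.- t′ K) ℤ.+ (t L ℤ.- t′ L)
sum-differ-at₂ t t′ {K} {L} K≢L agree = begin
  ℤΣ.sum t
    ≡⟨ sum-differ-at t t″ L agree-off-L ⟩
  ℤΣ.sum t″ ℤ.+ (t L ℤ.- t″ L)
    ≡⟨ cong₂ (λ a b → a ℤ.+ (t L ℤ.- b)) (sum-differ-at t″ t′ K agree-off-K) t″L ⟩
  ℤΣ.sum t′ ℤ.+ (t″ K ℤ.- t′ K) ℤ.+ (t L ℤ.- t′ L)
    ≡⟨ cong (λ a → ℤΣ.sum t′ ℤ.+ (a ℤ.- t′ K) ℤ.+ (t L ℤ.- t′ L)) t″K ⟩
  ℤΣ.sum t′ ℤ.+ (t K ℤ.- t′ K) ℤ.+ (t L ℤ.- t′ L)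
    ∎
  where
  open ≡-Reasoning
  t″ = updateAt t′ K (const (t K))
  t″K : t″ K ≡ t K
  t″K = updateAt-updates K t′
  t″L : t″ L ≡ t′ L
  t″L = updateAt-minimal L K t′ (K≢L ∘ sym)
  agree-off-K : ∀ j → j ≢ K → t″ j ≡ t′ j
  agree-off-K j j≢K = updateAt-minimal j K t′ j≢K
  agree-off-L : ∀ j → j ≢ L → t j ≡ t″ j
  agree-off-L j j≢L with j ≟ K
  ... | yes refl = sym t″K
  ... | no  j≢K  = trans (agree j j≢K j≢L) (sym (agree-off-K j j≢K))

HasSizes : ∀ {n} → (Fin 4 → ℕ) → Partition4 n → Set
HasSizes p f = ∀ k → size f k ≡ p k

-- Minimality over labelled partitions with |A_k| = p k; Minimal quantifies over all relabellings.
record Optimal {n} (s : ℕ) (p : Fin 4 → ℕ) (f : Partition4 n) : Set where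
  constructor optimal
  field
    sizes   : HasSizes p f
    minimal : ∀ (g : Partition4 n) → HasSizes p g → dev s f ℤ.≤ dev s g

partSum-swapAt : ∀ {n} (f : Partition4 n) {x y} → Adjacent x y →
                 MovesUnit (partSum f) (partSum (swapAt f x y)) (f y) (f x)
partSum-swapAt f {x} {y} adj k =
  subst₂ (λ a b → a + δ (f y) k ≡ b + δ (f x) k)
         (sym (partSum≡labelSum (swapAt f x y) k)) (sym (partSum≡labelSum f k)) (labelSum-swapAt f adj k)

size-swapAt : ∀ {n} (f : Partition4 n) x y k → size (swapAt f x y) k ≡ size f k
size-swapAt f x y k = trans (size≡labelCount (swapAt f x y) k) (trans (labelCount-swapAt f x y k) (sym (size≡labelCount f k)))

size-relabel : ∀ {n} (f : Partition4 n) (π : Permutation′ 4) k → size ((π ⟨$⟩ʳ_) ∘ f) k ≡ size f (π ⟨$⟩ˡ k)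
size-relabel f π k =
  trans (size≡labelCount ((π ⟨$⟩ʳ_) ∘ f) k) (trans (weight-relabel (const 1) f π k) (sym (size≡labelCount f (π ⟨$⟩ˡ k))))

partSum-relabel : ∀ {n} (f : Partition4 n) (π : Permutation′ 4) k → partSum ((π ⟨$⟩ʳ_) ∘ f) k ≡ partSum f (π ⟨$⟩ˡ k)
partSum-relabel f π k =
  trans (partSum≡labelSum ((π ⟨$⟩ʳ_) ∘ f) k) (trans (weight-relabel _ f π k) (sym (partSum≡labelSum f (π ⟨$⟩ˡ k))))

size-cong : ∀ {n} {f g : Partition4 n} → f ≗ g → ∀ k → size f k ≡ size g k
size-cong {f = f} {g} f≗g k =
  trans (size≡labelCount f k) (trans (weight-cong (λ _ → refl) f≗g k) (sym (size≡labelCount g k)))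

partSum-cong : ∀ {n} {f g : Partition4 n} → f ≗ g → ∀ k → partSum f k ≡ partSum g k
partSum-cong {f = f} {g} f≗g k =
  trans (partSum≡labelSum f k) (trans (weight-cong (λ _ → refl) f≗g k) (sym (partSum≡labelSum g k)))

module Deviation where
  open import Data.Integer using (+_)

  spread : ∀ {m} → ℕ → (Fin m → ℕ) → ℤ
  spread s u = ℤΣ.sum (λ k → sq (+ u k ℤ.- + s))

  dev≡spread : ∀ {n} s (f : Partition4 n) → dev s f ≡ spread s (partSum f)
  dev≡spread s f = cong (λ x → t zero ℤ.+ (t (suc zero) ℤ.+ (t (suc (suc zero)) ℤ.+ x))) (sym (ℤₚ.+-identityʳ _))
    where t = λ k → sq (+ partSum f k ℤ.- + s)

  spread-cong : ∀ {m} s {u v : Fin m → ℕ} → u ≗ v → spread s u ≡ spread s v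
  spread-cong s u≗v = ℤΣ.sum-cong-≗ (λ k → cong (λ x → sq (+ x ℤ.- + s)) (u≗v k))

  dev-cong : ∀ {n} s {f g : Partition4 n} → f ≗ g → dev s f ≡ dev s g
  dev-cong s {f} {g} f≗g = trans (dev≡spread s f) (trans (spread-cong s (partSum-cong f≗g)) (sym (dev≡spread s g)))

  spread-∘-permutation : ∀ {m} s (u : Fin m → ℕ) (π : Permutation′ m) → spread s (u ∘ (π ⟨$⟩ˡ_)) ≡ spread s u
  spread-∘-permutation s u π = sym (ℤΣ.sum-permute (λ k → sq (+ u k ℤ.- + s)) (Perm.flip π))

  dev-relabel : ∀ {n} s (f : Partition4 n) (π : Permutation′ 4) → dev s ((π ⟨$⟩ʳ_) ∘ f) ≡ dev s f
  dev-relabel s f π = begin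
    dev s ((π ⟨$⟩ʳ_) ∘ f)                 ≡⟨ dev≡spread s ((π ⟨$⟩ʳ_) ∘ f) ⟩
    spread s (partSum ((π ⟨$⟩ʳ_) ∘ f))    ≡⟨ spread-cong s (partSum-relabel f π) ⟩
    spread s (partSum f ∘ (π ⟨$⟩ˡ_))      ≡⟨ spread-∘-permutation s (partSum f) π ⟩
    spread s (partSum f)                  ≡⟨ dev≡spread s f ⟨
    dev s f                               ∎
    where open ≡-Reasoning

  -- (x + 1 − s)² − (x − s)² = 2 (x − s) + 1 at the gaining part, the reverse at the losing one.
  spread-moves : ∀ {m} s {u v : Fin m → ℕ} {L K} → MovesUnit u v L K → K ≢ L →
                 spread s v ≡ spread s u ℤ.+ + 2 ℤ.* (+ suc (u K) ℤ.- + u L)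
  spread-moves s {u} {v} {L} {K} moves K≢L = begin
    spread s v
      ≡⟨ sum-differ-at₂ (excess² v) (excess² u) K≢L (λ j j≢K j≢L → cong (λ x → sq (+ x ℤ.- + s)) (moves-other moves j≢K j≢L)) ⟩
    spread s u ℤ.+ (excess² v K ℤ.- excess² u K) ℤ.+ (excess² v L ℤ.- excess² u L)
      ≡⟨ cong₂ (λ a b → spread s u ℤ.+ (sq (+ a ℤ.- + s) ℤ.- excess² u K) ℤ.+ (excess² v L ℤ.- sq (+ b ℤ.- + s)))
               (moves-gain moves K≢L) (moves-loss moves K≢L) ⟩
    spread s u ℤ.+ (sq (+ suc (u K) ℤ.- + s) ℤ.- excess² u K) ℤ.+ (excess² v L ℤ.- sq (+ suc (v L) ℤ.- + s))
      ≡⟨ difference-of-squares (spread s u) (+ u K) (+ v L) (+ s) ⟩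
    spread s u ℤ.+ + 2 ℤ.* (+ suc (u K) ℤ.- + suc (v L))
      ≡⟨ cong (λ b → spread s u ℤ.+ + 2 ℤ.* (+ suc (u K) ℤ.- + b)) (moves-loss moves K≢L) ⟨
    spread s u ℤ.+ + 2 ℤ.* (+ suc (u K) ℤ.- + u L) ∎
    where
    open ≡-Reasoning
    excess² : (Fin _ → ℕ) → Fin _ → ℤ
    excess² w k = sq (+ w k ℤ.- + s)
    difference-of-squares : ∀ D A B S →
      D ℤ.+ ((+ 1 ℤ.+ A ℤ.- S) ℤ.* (+ 1 ℤ.+ A ℤ.- S) ℤ.- (A ℤ.- S) ℤ.* (A ℤ.- S))
        ℤ.+ ((B ℤ.- S) ℤ.* (B ℤ.- S) ℤ.- (+ 1 ℤ.+ B ℤ.- S) ℤ.* (+ 1 ℤ.+ B ℤ.- S))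
      ≡ D ℤ.+ + 2 ℤ.* ((+ 1 ℤ.+ A) ℤ.- (+ 1 ℤ.+ B))
    difference-of-squares = ℤSolver.solve-∀

  dev-swapAt : ∀ {n} s (f : Partition4 n) {x y} → Adjacent x y → f x ≢ f y →
               dev s (swapAt f x y) ≡ dev s f ℤ.+ + 2 ℤ.* (+ suc (partSum f (f x)) ℤ.- + partSum f (f y))
  dev-swapAt s f {x} {y} adj fx≢fy = begin
    dev s (swapAt f x y)              ≡⟨ dev≡spread s (swapAt f x y) ⟩
    spread s (partSum (swapAt f x y)) ≡⟨ spread-moves s (partSum-swapAt f adj) fx≢fy ⟩
    spread s (partSum f) ℤ.+ _        ≡⟨ cong (ℤ._+ _) (dev≡spread s f) ⟨
    dev s f ℤ.+ _                     ∎
    where open ≡-Reasoning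

  D≤D+2[a-b]⇒b≤a : ∀ D a b → D ℤ.≤ D ℤ.+ + 2 ℤ.* (+ a ℤ.- + b) → b ≤ a
  D≤D+2[a-b]⇒b≤a D a b D≤ =
    *-cancelˡ-≤ 2 (ℤₚ.drop‿+≤+ (subst₂ ℤ._≤_ (trans (cancel D (+ b)) (sym (ℤₚ.pos-* 2 b)))
                                               (trans (shift D (+ a) (+ b)) (sym (ℤₚ.pos-* 2 a)))
                                               (ℤₚ.+-monoˡ-≤ (ℤ.- D ℤ.+ + 2 ℤ.* + b) D≤)))
    where
    cancel : ∀ D B → D ℤ.+ (ℤ.- D ℤ.+ + 2 ℤ.* B) ≡ + 2 ℤ.* B
    cancel = ℤSolver.solve-∀
    shift : ∀ D A B → D ℤ.+ + 2 ℤ.* (A ℤ.- B) ℤ.+ (ℤ.- D ℤ.+ + 2 ℤ.* B) ≡ + 2 ℤ.* A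
    shift = ℤSolver.solve-∀

  D+2[a-a]≡D : ∀ D a → D ℤ.+ + 2 ℤ.* (+ a ℤ.- + a) ≡ D
  D+2[a-a]≡D D a = vanish D (+ a)
    where
    vanish : ∀ D A → D ℤ.+ + 2 ℤ.* (A ℤ.- A) ≡ D
    vanish = ℤSolver.solve-∀

  -- Otherwise exchanging x and y would lower the deviation.
  optimal-adjacent-≤ : ∀ {n s p} {f : Partition4 n} → Optimal s p f → ∀ {x y} → Adjacent x y → f x ≢ f y →
                       partSum f (f y) ≤ suc (partSum f (f x))
  optimal-adjacent-≤ {s = s} {f = f} (optimal sizes minimal) {x} {y} adj fx≢fy =
    D≤D+2[a-b]⇒b≤a (dev s f) _ _
      (subst (dev s f ℤ.≤_) (dev-swapAt s f adj fx≢fy) (minimal (swapAt f x y) (λ k → trans (size-swapAt f x y k) (sizes k))))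

  optimal-adjacent-swap : ∀ {n s p} {f : Partition4 n} → Optimal s p f → ∀ {x y} → Adjacent x y → f x ≢ f y →
                          partSum f (f y) ≡ suc (partSum f (f x)) → Optimal s p (swapAt f x y)
  optimal-adjacent-swap {s = s} {f = f} (optimal sizes minimal) {x} {y} adj fx≢fy tight =
    optimal (λ k → trans (size-swapAt f x y k) (sizes k))
            (λ g g-sizes → subst (ℤ._≤ dev s g) (sym same-dev) (minimal g g-sizes))
    where
    same-dev : dev s (swapAt f x y) ≡ dev s f
    same-dev = trans (dev-swapAt s f adj fx≢fy)
                     (trans (cong (λ b → dev s f ℤ.+ + 2 ℤ.* (+ suc (partSum f (f x)) ℤ.- + b)) tight)
                            (D+2[a-a]≡D (dev s f) (suc (partSum f (f x)))))

open Deviation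

optimal⇒minimal : ∀ {n s p} {f : Partition4 n} → Optimal s p f → Minimal s p f
optimal⇒minimal {s = s} {p} {f} (optimal sizes minimal) = (Perm.id , sizes) , below-all
  where
  below-all : ∀ g → Implements p g → dev s f ℤ.≤ dev s g
  below-all g (σ , g-sizes) =
    subst (dev s f ℤ.≤_) (dev-relabel s g σ)
          (minimal ((σ ⟨$⟩ʳ_) ∘ g)
                   (λ k → trans (size-relabel g σ k) (trans (g-sizes (σ ⟨$⟩ˡ k)) (cong p (Perm.inverseʳ σ)))))

-- Existence of an optimal partition

allFunctions : ∀ n m → List (Fin n → Fin m)
allFunctions zero    m = List.[ (λ ()) ]
allFunctions (suc n) m = List.cartesianProductWith Vector._∷_ (allFin m) (allFunctions n m)

allFunctions-complete : ∀ {n m} (g : Fin n → Fin m) → ∃[ h ] (h ∈ allFunctions n m × h ≗ g)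
allFunctions-complete {zero}  g = (λ ()) , here refl , λ ()
allFunctions-complete {suc n} g with allFunctions-complete (g ∘ suc)
... | h , h∈ , h≗g =
  g zero Vector.∷ h , ∈-cartesianProductWith⁺ Vector._∷_ (∈-allFin (g zero)) h∈ , λ { zero → refl ; (suc i) → h≗g i }

block : ∀ {m} (q : Fin m → ℕ) → Fin (∑ q) → Fin m
block {suc m} q i = [ const zero , suc ∘ block (q ∘ suc) ]′ (Fin.splitAt (q zero) i)

labelCount-block : ∀ {m} (q : Fin m → ℕ) k → labelCount (block q) k ≡ q k
labelCount-block {suc m} q k =
  trans (∑-splitAt (q zero) _) (trans (cong₂ _+_ (∑-cong first) (∑-cong second)) (by-label k))
  where
  q′ = q ∘ suc
  first : ∀ i → δ (block q (i Fin.↑ˡ ∑ q′)) k ≡ δ zero k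
  first i = cong (λ c → δ ([ const zero , suc ∘ block q′ ]′ c) k) (Finₚ.splitAt-↑ˡ (q zero) i (∑ q′))
  second : ∀ j → δ (block q (q zero Fin.↑ʳ j)) k ≡ δ (suc (block q′ j)) k
  second j = cong (λ c → δ ([ const zero , suc ∘ block q′ ]′ c) k) (Finₚ.splitAt-↑ʳ (q zero) (∑ q′) j)
  by-label : ∀ k → ∑[ i < q zero ] δ zero k + ∑[ j < ∑ q′ ] δ (suc (block q′ j)) k ≡ q k
  by-label zero    = trans (cong₂ _+_ (∑-ones (q zero)) (∑-zero (∑ q′))) (+-identityʳ (q zero))
  by-label (suc k) = trans (cong (_+ ∑[ j < ∑ q′ ] δ (suc (block q′ j)) (suc k)) (∑-zero (q zero)))
                           (trans (∑-cong (λ j → δ-suc (block q′ j) k)) (labelCount-block q′ k))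

partition-with-sizes : ∀ {n m} (q : Fin m → ℕ) → ∑ q ≡ n → ∃[ f ] (∀ k → labelCount {n} f k ≡ q k)
partition-with-sizes q refl = block q , labelCount-block q

optimal-exists : ∀ {n} s p → ∃[ f ] HasSizes {n} p f → ∃[ f ] Optimal s p f
optimal-exists {n} s p (f₀ , f₀-sizes) =
  f★ , optimal (argmin-all (dev s) f₀-sizes (all-filter hasSizes? (allFunctions n 4))) minimal
  where
  hasSizes? : ∀ f → Dec (HasSizes p f)
  hasSizes? f = Finₚ.all? (λ k → size f k ℕ.≟ p k)
  candidates : List (Partition4 n)
  candidates = List.filter hasSizes? (allFunctions n 4)
  f★ : Partition4 n
  f★ = argmin (dev s) f₀ candidates
  minimal : ∀ g → HasSizes p g → dev s f★ ℤ.≤ dev s g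
  minimal g g-sizes = below (allFunctions-complete g)
    where
    below : ∃[ h ] (h ∈ allFunctions n 4 × h ≗ g) → dev s f★ ℤ.≤ dev s g
    below (h , h∈ , h≗g) =
      subst (dev s f★ ℤ.≤_) (dev-cong s h≗g)
            (All.lookup (f[argmin]≤f[xs] f₀ candidates) (∈-filter⁺ hasSizes? h∈ (λ k → trans (size-cong h≗g k) (g-sizes k))))

-- Optimal partitions of finite width

does-true : ∀ {P : Set} (d : Dec P) → does d ≡ true → P
does-true (yes p) _  = p
does-true (no  _) ()

does-false : ∀ {P : Set} (d : Dec P) → does d ≡ false → ¬ P
does-false (yes _)  ()
does-false (no  ¬p) _ = ¬p

Adjacent⇒< : ∀ {n} {x y : Fin n} → Adjacent x y → toℕ x < toℕ y
Adjacent⇒< adj = ≤-reflexive (sym adj)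

finiteWidth? : ∀ {n} s (f : Partition4 n) → Dec (FiniteWidth s f)
finiteWidth? s f = Finₚ.any? λ x → Finₚ.any? λ y →
  (toℕ x ℕ.<? toℕ y) ×-dec (s ℕ.<? partSum f (f y)) ×-dec (partSum f (f x) ℕ.<? s)

Distinct4 : (a b c d : Fin 4) → Set
Distinct4 a b c d = a ≢ b × a ≢ c × a ≢ d × b ≢ c × b ≢ d × c ≢ d

distinct4⇒covers : ∀ a b c d → Distinct4 a b c d → ∀ k → k ≡ a ⊎ k ≡ b ⊎ k ≡ c ⊎ k ≡ d
distinct4⇒covers = from-yes (Finₚ.all? λ a → Finₚ.all? λ b → Finₚ.all? λ c → Finₚ.all? λ d →
  distinct? a b c d →-dec Finₚ.all? λ k → (k ≟ a) ⊎-dec (k ≟ b) ⊎-dec (k ≟ c) ⊎-dec (k ≟ d))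
  where
  distinct? : ∀ a b c d → Dec (Distinct4 a b c d)
  distinct? a b c d = ¬? (a ≟ b) ×-dec ¬? (a ≟ c) ×-dec ¬? (a ≟ d) ×-dec ¬? (b ≟ c) ×-dec ¬? (b ≟ d) ×-dec ¬? (c ≟ d)

module Narrow {n s : ℕ} {p : Fin 4 → ℕ} (sorted : Sorted p) (condition : TopSumCondition n s p)
              {f : Partition4 n} (f-opt : Optimal s p f) (narrow : ¬ FiniteWidth s f) where

  drop-in-underfull-parts : (T : Fin 4 → Bool) → (∀ k → T k ≡ true → partSum f k ≤ s) →
                            ∀ k₀ → T k₀ ≡ true → partSum f k₀ < s → HasDrop (T ∘ f)
  drop-in-underfull-parts T ≤s k₀ Tk₀ k₀<s =
    drop-in-underfull-union sorted condition f (λ k → trans (sym (size≡labelCount f k)) (Optimal.sizes f-opt k))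
      T (λ k Tk → subst (_≤ s) (partSum≡labelSum f k) (≤s k Tk)) k₀ Tk₀ (subst (_< s) (partSum≡labelSum f k₀) k₀<s)

  ≢-by-sums : ∀ {K L} → partSum f K < partSum f L → K ≢ L
  ≢-by-sums lt K≡L = <-irrefl (cong (partSum f) K≡L) lt

  exact-then-high : ∀ {kL} → partSum f kL < s →
                    ∃[ a′ ] ∃[ a ] (Adjacent a′ a × partSum f (f a′) ≡ s × partSum f (f a) ≡ suc s)
  exact-then-high {kL} kL-low
    with drop-in-underfull-parts notHigh (λ k → does-true (partSum f k ≤? s))
                                 kL (dec-true (partSum f kL ≤? s) (<⇒≤ kL-low)) kL-low
    where notHigh = λ k → does (partSum f k ≤? s)
  ... | a′ , a , a′a , a′-notHigh , a-high = a′ , a , a′a , a′-exact , a-exact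
    where
    high : s < partSum f (f a)
    high = ≰⇒> (does-false (partSum f (f a) ≤? s) a-high)
    a′-exact : partSum f (f a′) ≡ s
    a′-exact = ≤-antisym (does-true (partSum f (f a′) ≤? s) a′-notHigh)
                         (≮⇒≥ (λ low → narrow (a′ , a , Adjacent⇒< a′a , high , low)))
    a-exact : partSum f (f a) ≡ suc s
    a-exact = ≤-antisym (subst (λ t → partSum f (f a) ≤ suc t) a′-exact
                                (optimal-adjacent-≤ f-opt a′a (≢-by-sums (subst (_< partSum f (f a)) (sym a′-exact) high))))
                        high

  low-then-exact : ∀ {kL} → partSum f kL < s →
                   ∃[ b ] ∃[ b′ ] (Adjacent b b′ × suc (partSum f (f b)) ≡ s × partSum f (f b′) ≡ s)
  low-then-exact {kL} kL-low
    with drop-in-underfull-parts low (λ k → <⇒≤ ∘ does-true (partSum f k <? s))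
                                 kL (dec-true (partSum f kL <? s) kL-low) kL-low
    where low = λ k → does (partSum f k <? s)
  ... | b , b′ , bb′ , b-low , b′-notLow = b , b′ , bb′ , b-exact , b′-exact
    where
    below : partSum f (f b) < s
    below = does-true (partSum f (f b) <? s) b-low
    b′-exact : partSum f (f b′) ≡ s
    b′-exact = ≤-antisym (≮⇒≥ (λ high → narrow (b , b′ , Adjacent⇒< bb′ , high , below)))
                         (≮⇒≥ (does-false (partSum f (f b′) <? s) b′-notLow))
    b-exact : suc (partSum f (f b)) ≡ s
    b-exact = ≤-antisym below (subst (_≤ suc (partSum f (f b))) b′-exact
                                     (optimal-adjacent-≤ f-opt bb′ (≢-by-sums (subst (partSum f (f b) <_) (sym b′-exact) below))))

  module Boundary {a′ a b b′ : Fin n} (a′a : Adjacent a′ a) (bb′ : Adjacent b b′)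
                 (a′-exact : partSum f (f a′) ≡ s) (a-exact : partSum f (f a) ≡ suc s)
                 (b-exact : suc (partSum f (f b)) ≡ s) (b′-exact : partSum f (f b′) ≡ s) where

    A B E E′ : Fin 4
    A = f a
    B = f b
    E = f b′
    E′ = f a′

    A-high : s < partSum f A
    A-high = subst (s <_) (sym a-exact) ≤-refl

    B-low : partSum f B < s
    B-low = subst (partSum f B <_) b-exact ≤-refl

    B≢E : B ≢ E
    B≢E = ≢-by-sums (subst (partSum f B <_) (sym b′-exact) B-low)

    B≢E′ : B ≢ E′
    B≢E′ = ≢-by-sums (subst (partSum f B <_) (sym a′-exact) B-low)

    A≢B : A ≢ B
    A≢B = ≢-by-sums (<-trans B-low A-high) ∘ sym

    A≢E : A ≢ E
    A≢E = ≢-by-sums (subst (_< partSum f A) (sym b′-exact) A-high) ∘ sym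

    A≢E′ : A ≢ E′
    A≢E′ = ≢-by-sums (subst (_< partSum f A) (sym a′-exact) A-high) ∘ sym

    apart : ∀ {i j K L} → f i ≡ K → f j ≡ L → K ≢ L → i ≢ j
    apart fi≡K fj≡L K≢L i≡j = K≢L (trans (sym fi≡K) (trans (cong f i≡j) fj≡L))

    a<b : toℕ a < toℕ b
    a<b with <-cmp (toℕ a) (toℕ b)
    ... | tri< a<b _   _   = a<b
    ... | tri≈ _   a≡b _   = ⊥-elim (A≢B (cong f (Finₚ.toℕ-injective a≡b)))
    ... | tri> _   _   b<a = ⊥-elim (narrow (b , a , b<a , A-high , B-low))

    a′<a : toℕ a′ < toℕ a
    a′<a = Adjacent⇒< a′a

    b<b′ : toℕ b < toℕ b′
    b<b′ = Adjacent⇒< bb′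

    a′<b′ : toℕ a′ < toℕ b′
    a′<b′ = <-trans a′<a (<-trans a<b b<b′)

    f-high : ∀ {i} → f i ≡ A → InHigh s f i
    f-high fi≡A = subst (λ c → s < partSum f c) (sym fi≡A) A-high

    f-low : ∀ {i} → f i ≡ B → InLow s f i
    f-low fi≡B = subst (λ c → partSum f c < s) (sym fi≡B) B-low

    g : Partition4 n
    g = swapAt f b b′

    g-opt : Optimal s p g
    g-opt = optimal-adjacent-swap f-opt bb′ B≢E (trans b′-exact (sym b-exact))

    g-moves : MovesUnit (partSum f) (partSum g) E B
    g-moves = partSum-swapAt f bb′

    g-fixes : ∀ {i} → i ≢ b → i ≢ b′ → g i ≡ f i
    g-fixes = swapAt-other f

    gE-low : partSum g E < s
    gE-low = subst (partSum g E <_) (trans (sym (moves-loss g-moves B≢E)) b′-exact) ≤-refl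

    gE′-exact : E′ ≢ E → partSum g E′ ≡ s
    gE′-exact E′≢E = trans (moves-other g-moves (B≢E′ ∘ sym) E′≢E) a′-exact

    g-high : ∀ {i} → f i ≡ A → InHigh s g i
    g-high fi≡A = subst (λ c → s < partSum g c) (sym (trans (g-fixes (apart fi≡A refl A≢B) (apart fi≡A refl A≢E)) fi≡A))
                        (subst (s <_) (sym (moves-other g-moves A≢B A≢E)) A-high)

    g-low : ∀ {i} → f i ≡ E → i ≢ b′ → InLow s g i
    g-low fi≡E i≢b′ =
      subst (λ c → partSum g c < s) (sym (trans (g-fixes (apart fi≡E refl (B≢E ∘ sym)) i≢b′) fi≡E)) gE-low

    h : Partition4 n
    h = swapAt f a′ a

    h-opt : Optimal s p h
    h-opt = optimal-adjacent-swap f-opt a′a (A≢E′ ∘ sym) (trans a-exact (cong suc (sym a′-exact)))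

    h-moves : MovesUnit (partSum f) (partSum h) A E′
    h-moves = partSum-swapAt f a′a

    h-fixes : ∀ {i} → i ≢ a′ → i ≢ a → h i ≡ f i
    h-fixes = swapAt-other f

    hE′-high : s < partSum h E′
    hE′-high = subst (s <_) (sym (trans (moves-gain h-moves (A≢E′ ∘ sym)) (cong suc a′-exact))) ≤-refl

    h-high : ∀ {i} → f i ≡ E′ → i ≢ a′ → InHigh s h i
    h-high fi≡E′ i≢a′ =
      subst (λ c → s < partSum h c) (sym (trans (h-fixes i≢a′ (apart fi≡E′ refl (A≢E′ ∘ sym))) fi≡E′)) hE′-high

    h-low : ∀ {i} → f i ≡ B → InLow s h i
    h-low fi≡B =
      subst (λ c → partSum h c < s) (sym (trans (h-fixes (apart fi≡B refl B≢E′) (apart fi≡B refl (A≢B ∘ sym))) fi≡B))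
            (subst (_< s) (sym (moves-other h-moves B≢E′ (A≢B ∘ sym))) B-low)

    exchange-in-g : ∀ {y y₁} → Adjacent y y₁ → f y ≡ E → f y₁ ≡ E′ → y ≢ b′ → y₁ ≢ a′ → E ≢ E′ →
                    ∃[ k ] (Optimal s p k × FiniteWidth s k)
    exchange-in-g {y} {y₁} yy₁ fy≡E fy₁≡E′ y≢b′ y₁≢a′ E≢E′ = k , k-opt , a′ , a , a′<a , k-high , k-low
      where
      gy : g y ≡ E
      gy = trans (g-fixes (apart fy≡E refl (B≢E ∘ sym)) y≢b′) fy≡E
      gy₁ : g y₁ ≡ E′
      gy₁ = trans (g-fixes (apart fy₁≡E′ refl (B≢E′ ∘ sym)) (apart fy₁≡E′ refl (E≢E′ ∘ sym))) fy₁≡E′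
      tight : partSum g E′ ≡ suc (partSum g E)
      tight = trans (gE′-exact (E≢E′ ∘ sym)) (trans (sym b′-exact) (moves-loss g-moves B≢E))
      k : Partition4 n
      k = swapAt g y y₁
      k-opt : Optimal s p k
      k-opt = optimal-adjacent-swap g-opt yy₁ (subst₂ _≢_ (sym gy) (sym gy₁) E≢E′)
                                    (subst₂ (λ K L → partSum g L ≡ suc (partSum g K)) (sym gy) (sym gy₁) tight)
      k-moves : MovesUnit (partSum g) (partSum k) E′ E
      k-moves = subst₂ (MovesUnit (partSum g) (partSum k)) gy₁ gy (partSum-swapAt g yy₁)
      ka′ : k a′ ≡ E′
      ka′ = trans (swapAt-other g (apart refl fy≡E (E≢E′ ∘ sym)) (y₁≢a′ ∘ sym))
                  (g-fixes (Finₚ.<⇒≢ (<-trans a′<a a<b)) (Finₚ.<⇒≢ a′<b′))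
      ka : k a ≡ A
      ka = trans (swapAt-other g (apart refl fy≡E A≢E) (apart refl fy₁≡E′ A≢E′))
                 (g-fixes (apart refl refl A≢B) (apart refl refl A≢E))
      k-high : s < partSum k (k a)
      k-high = subst (λ c → s < partSum k c) (sym ka)
                     (subst (s <_) (sym (trans (moves-other k-moves A≢E A≢E′) (moves-other g-moves A≢B A≢E))) A-high)
      k-low : partSum k (k a′) < s
      k-low = subst (λ c → partSum k c < s) (sym ka′)
                    (subst (partSum k E′ <_) (trans (sym (moves-loss k-moves E≢E′)) (gE′-exact (E≢E′ ∘ sym))) ≤-refl)

    both-narrow : ¬ FiniteWidth s g → ¬ FiniteWidth s h → ∃[ k ] (Optimal s p k × FiniteWidth s k)
    both-narrow g-narrow h-narrow
      with drop-in-underfull-parts (λ k → does (B-or-E? k)) B-or-E-≤ B (dec-true (B-or-E? B) (inj₁ refl)) B-low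
      where
      B-or-E? : ∀ k → Dec (k ≡ B ⊎ k ≡ E)
      B-or-E? k = (k ≟ B) ⊎-dec (k ≟ E)
      B-or-E-≤ : ∀ k → does (B-or-E? k) ≡ true → partSum f k ≤ s
      B-or-E-≤ k k∈ with does-true (B-or-E? k) k∈
      ... | inj₁ refl = <⇒≤ B-low
      ... | inj₂ refl = ≤-reflexive b′-exact
    ... | y , y₁ , yy₁ , y∈ , y₁∉ = cases yy₁ (does-true ((f y ≟ B) ⊎-dec (f y ≟ E)) y∈)
                                              (outside (does-false ((f y₁ ≟ B) ⊎-dec (f y₁ ≟ E)) y₁∉))
      where
      E≢E′ : E ≢ E′
      E≢E′ E≡E′ = g-narrow (a′ , a , a′<a , g-high refl , g-low (sym E≡E′) (Finₚ.<⇒≢ a′<b′))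
      outside : ∀ {K} → ¬ (K ≡ B ⊎ K ≡ E) → K ≡ A ⊎ K ≡ E′
      outside {K} K∉ = [ inj₁ , [ ⊥-elim ∘ K∉ ∘ inj₁ , [ ⊥-elim ∘ K∉ ∘ inj₂ , inj₂ ]′ ]′ ]′
                         (distinct4⇒covers A B E E′ (A≢B , A≢E , A≢E′ , B≢E , B≢E′ , E≢E′) K)
      cases : ∀ {y y₁} → Adjacent y y₁ → f y ≡ B ⊎ f y ≡ E → f y₁ ≡ A ⊎ f y₁ ≡ E′ →
              ∃[ k ] (Optimal s p k × FiniteWidth s k)
      cases {y} {y₁} yy₁ (inj₁ fy≡B) (inj₁ fy₁≡A) =
        ⊥-elim (narrow (y , y₁ , Adjacent⇒< yy₁ , f-high fy₁≡A , f-low fy≡B))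
      cases {y} {y₁} yy₁ (inj₂ fy≡E) (inj₁ fy₁≡A) = ⊥-elim (E-then-A (y ≟ b′))
        where
        E-then-A : Dec (y ≡ b′) → ⊥
        E-then-A (yes refl) = narrow (b , y₁ , <-trans b<b′ (Adjacent⇒< yy₁) , f-high fy₁≡A , B-low)
        E-then-A (no  y≢b′) = g-narrow (y , y₁ , Adjacent⇒< yy₁ , g-high fy₁≡A , g-low fy≡E y≢b′)
      cases {y} {y₁} yy₁ (inj₁ fy≡B) (inj₂ fy₁≡E′) = ⊥-elim (B-then-E′ (y₁ ≟ a′))
        where
        B-then-E′ : Dec (y₁ ≡ a′) → ⊥
        B-then-E′ (yes refl) = narrow (y , a , <-trans (Adjacent⇒< yy₁) a′<a , A-high , f-low fy≡B)
        B-then-E′ (no  y₁≢a′) = h-narrow (y , y₁ , Adjacent⇒< yy₁ , h-high fy₁≡E′ y₁≢a′ , h-low fy≡B)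
      cases {y} {y₁} yy₁ (inj₂ fy≡E) (inj₂ fy₁≡E′) = E-then-E′ (y ≟ b′) (y₁ ≟ a′)
        where
        E-then-E′ : Dec (y ≡ b′) → Dec (y₁ ≡ a′) → ∃[ k ] (Optimal s p k × FiniteWidth s k)
        E-then-E′ (yes refl) _ =
          ⊥-elim (h-narrow (b , y₁ , b<y₁ , h-high fy₁≡E′ (Finₚ.<⇒≢ (<-trans (<-trans a′<a a<b) b<y₁) ∘ sym) , h-low refl))
          where b<y₁ = <-trans b<b′ (Adjacent⇒< yy₁)
        E-then-E′ (no y≢b′) (yes refl) =
          ⊥-elim (g-narrow (y , a , <-trans (Adjacent⇒< yy₁) a′<a , g-high refl , g-low fy≡E y≢b′))
        E-then-E′ (no y≢b′) (no y₁≢a′) = exchange-in-g yy₁ fy≡E fy₁≡E′ y≢b′ y₁≢a′ E≢E′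

    result : ∃[ k ] (Optimal s p k × FiniteWidth s k)
    result = choose (finiteWidth? s g) (finiteWidth? s h)
      where
      choose : Dec (FiniteWidth s g) → Dec (FiniteWidth s h) → ∃[ k ] (Optimal s p k × FiniteWidth s k)
      choose (yes g-wide)   _             = g , g-opt , g-wide
      choose (no  _)        (yes h-wide)  = h , h-opt , h-wide
      choose (no  g-narrow) (no h-narrow) = both-narrow g-narrow h-narrow

  widen : ∀ {kL} → partSum f kL < s → ∃[ k ] (Optimal s p k × FiniteWidth s k)
  widen kL-low =
    let _ , _ , a′a , a′-exact , a-exact = exact-then-high kL-low
        _ , _ , bb′ , b-exact , b′-exact = low-then-exact kL-low
    in  Boundary.result a′a bb′ a′-exact a-exact b-exact b′-exact

optimal-with-finite-width : ∀ {n s} {p : Fin 4 → ℕ} {f : Partition4 n} → Sorted p → TopSumCondition n s p → Optimal s p f →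
                            ∃[ kL ] partSum f kL < s → ∃[ k ] (Optimal s p k × FiniteWidth s k)
optimal-with-finite-width {s = s} {p} {f} sorted condition f-opt (_ , kL-low) = choose (finiteWidth? s f)
  where
  choose : Dec (FiniteWidth s f) → ∃[ k ] (Optimal s p k × FiniteWidth s k)
  choose (yes wide)   = f , f-opt , wide
  choose (no  narrow) = Narrow.widen sorted condition f-opt narrow kL-low

low-part-exists : ∀ {n s} (f : Partition4 n) → 4 * s ≡ suc n C 2 → ¬ Equitable s f → ∃[ k ] partSum f k < s
low-part-exists {n} {s} f total not-equitable = choose (Finₚ.any? (λ k → partSum f k <? s))
  where
  total-partSum : 4 * s ≡ ∑[ k < 4 ] partSum f k
  total-partSum = trans total (sym (trans (∑-cong (partSum≡labelSum f)) (trans (∑-labelSum f) (∑-suc-toℕ n))))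
  exact : (∀ k → s ≤ partSum f k) → ∀ k → Dec (partSum f k ≡ s) → partSum f k ≡ s
  exact _        k (yes k-exact) = k-exact
  exact at-least k (no  k≢s)     = ⊥-elim (<-irrefl total-partSum (∑-mono-< at-least k (≤∧≢⇒< (at-least k) (k≢s ∘ sym))))
  choose : Dec (∃[ k ] partSum f k < s) → ∃[ k ] partSum f k < s
  choose (yes low)    = low
  choose (no  no-low) = ⊥-elim (not-equitable (λ k → exact at-least k (partSum f k ℕ.≟ s)))
    where
    at-least : ∀ k → s ≤ partSum f k
    at-least k = ≮⇒≥ (λ low → no-low (k , low))

partition-with-sizes-4 : ∀ {n} (p : Fin 4 → ℕ) → ∑ p ≡ n → ∃[ f ] HasSizes {n} p f
partition-with-sizes-4 p ∑p≡n =
  let f , counts = partition-with-sizes p ∑p≡n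
  in  f , λ k → trans (size≡labelCount f k) (counts k)

∑-lookup-4 : ∀ a b c d → ∑ (lookup (a ∷ b ∷ c ∷ d ∷ [])) ≡ a + b + c + d
∑-lookup-4 a b c d = sym (reassociate a b c d)
  where
  reassociate : ∀ a b c d → a + b + c + d ≡ a + (b + (c + (d + 0)))
  reassociate = solve-∀

sorted-4 : ∀ {a b c d} → a ≤ b → b ≤ c → c ≤ d → Sorted (lookup (a ∷ b ∷ c ∷ d ∷ []))
sorted-4 a≤b b≤c c≤d = a≤b , b≤c , c≤d , tt

topSumCondition-4 : ∀ {n s a b c d} →
  1 * s ≤ topSum n a → 2 * s ≤ topSum n (a + b) → 3 * s ≤ topSum n (a + b + c) → 4 * s ≤ topSum n (a + b + c + d) →
  TopSumCondition n s (lookup (a ∷ b ∷ c ∷ d ∷ []))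
topSumCondition-4 {n} {s} {a} {b} {c} {d} H₁ H₂ H₃ H₄ = condition
  where
  two : ∀ a b → a + b ≡ a + (b + 0)
  two = solve-∀
  three : ∀ a b c → a + b + c ≡ a + (b + (c + 0))
  three = solve-∀
  condition : ∀ j → j ≤ 4 → j * s ≤ topSum n (prefixSum (lookup (a ∷ b ∷ c ∷ d ∷ [])) j)
  condition 0 _ = z≤n
  condition 1 _ = subst (λ t → 1 * s ≤ topSum n t) (sym (+-identityʳ a)) H₁
  condition 2 _ = subst (λ t → 2 * s ≤ topSum n t) (two a b) H₂
  condition 3 _ = subst (λ t → 3 * s ≤ topSum n t) (three a b c) H₃
  condition 4 _ = subst (λ t → 4 * s ≤ topSum n t) (sym (∑-lookup-4 a b c d)) H₄
  condition (suc (suc (suc (suc (suc _))))) (s≤s (s≤s (s≤s (s≤s ()))))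

lemma5 : (n s p₁ p₂ p₃ p₄ : ℕ) →
  0 < n →
  4 * s ≡ suc n C 2 →
  0 < p₁ → p₁ ≤ p₂ → p₂ ≤ p₃ → p₃ ≤ p₄ →
  p₁ + p₂ + p₃ + p₄ ≡ n →
  1 * s ≤ topSum n p₁ →
  2 * s ≤ topSum n (p₁ + p₂) →
  3 * s ≤ topSum n (p₁ + p₂ + p₃) →
  4 * s ≤ topSum n (p₁ + p₂ + p₃ + p₄) →
  ¬ (∃[ f ] (Implements {n} (lookup (p₁ ∷ p₂ ∷ p₃ ∷ p₄ ∷ [])) f × Equitable s f)) →
  ∃[ f ] (Minimal {n} s (lookup (p₁ ∷ p₂ ∷ p₃ ∷ p₄ ∷ [])) f × FiniteWidth s f)
lemma5 n s p₁ p₂ p₃ p₄ _ total _ p₁≤p₂ p₂≤p₃ p₃≤p₄ ∑p≡n H₁ H₂ H₃ H₄ no-equitable =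
  let p             = lookup (p₁ ∷ p₂ ∷ p₃ ∷ p₄ ∷ [])
      f , f-opt     = optimal-exists s p (partition-with-sizes-4 p (trans (∑-lookup-4 p₁ p₂ p₃ p₄) ∑p≡n))
      not-equitable = λ equitable → no-equitable (f , proj₁ (optimal⇒minimal f-opt) , equitable)
      k , k-opt , k-wide = optimal-with-finite-width (sorted-4 p₁≤p₂ p₂≤p₃ p₃≤p₄) (topSumCondition-4 H₁ H₂ H₃ H₄)
                                                     f-opt (low-part-exists f total not-equitable)
  in k , optimal⇒minimal k-opt , k-wide
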